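{- Let $n$ be a positive integer and, for each positive integer $m$, let $\Omega_m$ be the graph whose vertices are all $\pm1$-vectors of length $m$, two vertices being adjacent if and only if they are orthogonal. Then the vertex set of $\Omega_{2n}$ can be partitioned into $2^{n-1}$ sets, each of which induces a subgraph of $\Omega_{2n}$ isomorphic to the join $\Omega_n+\Omega_n$.
   Context: The join $X_1+X_2$ of graphs $X_1,X_2$ is the complement of the disjoint union of their complements: the disjoint union of $X_1$ and $X_2$ together with all edges between $V(X_1)$ and $V(X_2)$. -}

module Defs where

open import Data.Bool using (Bool; true; false)
open import Data.Nat using (ℕ)
open import Data.Integer using (ℤ; +_; -[1+_]; _+_; _*_)
open import Data.Vec using (Vec; []; _∷_)
open import Data.Sum using (_⊎_; inj₁; inj₂)
open import Data.Product using (Σ; proj₁)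
open import Data.Unit using (⊤)
open import Data.Empty using (⊥)
open import Function.Bundles using (_↔_; _⇔_; Inverse)
open import Relation.Binary.PropositionalEquality using (_≡_)

record Graph : Set₁ where
  field
    V   : Set
    Adj : V → V → Set
open Graph public

sign : Bool → ℤ
sign true  = + 1
sign false = -[1+ 0 ]

dot : ∀ {m} → Vec Bool m → Vec Bool m → ℤ
dot []       []       = + 0
dot (x ∷ xs) (y ∷ ys) = sign x * sign y + dot xs ys

Ω : ℕ → Graph
Ω m = record { V = Vec Bool m ; Adj = λ u v → dot u v ≡ + 0 }

join : Graph → Graph → Graph
join X Y = record { V = V X ⊎ V Y ; Adj = adj }
  where
  adj : V X ⊎ V Y → V X ⊎ V Y → Set
  adj (inj₁ a) (inj₁ b) = Adj X a b
  adj (inj₁ _) (inj₂ _) = ⊤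
  adj (inj₂ _) (inj₁ _) = ⊤
  adj (inj₂ a) (inj₂ b) = Adj Y a b

induced : (X : Graph) → (V X → Set) → Graph
induced X S = record { V = Σ (V X) S ; Adj = λ u v → Adj X (proj₁ u) (proj₁ v) }

record _≅_ (X Y : Graph) : Set where
  field
    bij      : V X ↔ V Y
    adj-pres : ∀ u v → Adj X u v ⇔ Adj Y (Inverse.to bij u) (Inverse.to bij v)

{-# OPTIONS --safe #-}
-- Write a vertex of Ω(2n) as x ++ x ⊙ c, with ⊙ the pointwise product. Then
-- (x ++ x ⊙ c)·(y ++ y ⊙ d) = x·y + (x ⊙ c)·(y ⊙ d), which is 2 x·y for d = c and
-- 0 for d = -c. So for each c the vertices with c or -c in the second coordinate
-- induce Ω n + Ω n, and the 2^n vectors c form 2^(n-1) pairs {c, -c}, each labelled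
-- by its member with first entry +1.
module Submission where

open import Defs
open import Data.Nat as ℕ using (ℕ; zero; suc; _^_; _∸_; _≤_)
open import Data.Fin as Fin using (Fin)
open import Data.Fin.Properties using (2↔Bool; *↔×)
open import Data.Bool using (Bool; true; false; not)
open import Data.Bool.Properties using (not-involutive)
open import Data.Vec using (Vec; []; _∷_; _++_; map; zipWith; take; drop; uncons)
open import Data.Vec.Properties using (take++drop≡id; map-∘; map-cong; map-id)
open import Data.Sum using (_⊎_; inj₁; inj₂)
open import Data.Product using (Σ; _×_; _,_; proj₁; proj₂; uncurry)
open import Data.Product.Properties using (Σ-≡,≡→≡)
open import Data.Product.Function.NonDependent.Propositional using (_×-↔_)
open import Data.Unit using (tt)
open import Function using (_∘_)
open import Function.Bundles using (_↔_; _⇔_; Inverse; mk↔ₛ′; mk⇔)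
open import Function.Properties.Inverse using (↔-refl; ↔-sym; ↔-trans)
open import Axiom.UniquenessOfIdentityProofs using (UIP; module Decidable⇒UIP)
open import Relation.Binary.PropositionalEquality
  using (_≡_; refl; sym; trans; cong; cong₂; subst; subst₂; module ≡-Reasoning)

module _ {B : Set} (uip : UIP B) where

  fibre↔ : {A C : Set} (e : A ↔ (B × C)) (b : B) →
           Σ A (λ a → proj₁ (Inverse.to e a) ≡ b) ↔ C
  fibre↔ {A} {C} e b = mk↔ₛ′ (proj₂ ∘ to ∘ proj₁) section
    (λ c → cong proj₂ (strictlyInverseˡ (b , c)))
    (λ (a , p) → Σ-≡,≡→≡ (from-to a p , uip _ _))
    where
    open Inverse e
    section : C → Σ A (λ a → proj₁ (to a) ≡ b)
    section c = from (b , c) , cong proj₁ (strictlyInverseˡ (b , c))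
    from-to : ∀ a → proj₁ (to a) ≡ b → from (b , proj₂ (to a)) ≡ a
    from-to a p = trans (cong (λ b′ → from (b′ , proj₂ (to a))) (sym p)) (strictlyInverseʳ a)

  fibre-≅ : {X Y : Graph} (e : V X ↔ (B × V Y)) (b : B) →
            (∀ u w → Adj X (Inverse.from e (b , u)) (Inverse.from e (b , w)) ⇔ Adj Y u w) →
            induced X (λ v → proj₁ (Inverse.to e v) ≡ b) ≅ Y
  fibre-≅ {X} {Y} e b adj = record
    { bij      = fibre↔ e b
    ; adj-pres = λ s s′ → subst₂ (λ v v′ → Adj X v v′ ⇔ Adj Y _ _)
                            (from-to s) (from-to s′) (adj _ _)
    }
    where
    from-to : ∀ s → Inverse.from e (b , Inverse.to (fibre↔ e b) s) ≡ proj₁ s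
    from-to = cong proj₁ ∘ Inverse.strictlyInverseʳ (fibre↔ e b)

module _ {A : Set} where

  take-++ : ∀ {m p} (x : Vec A m) (y : Vec A p) → take m (x ++ y) ≡ x
  take-++ []      y = refl
  take-++ (a ∷ x) y = cong (a ∷_) (take-++ x y)

  drop-++ : ∀ {m p} (x : Vec A m) (y : Vec A p) → drop m (x ++ y) ≡ y
  drop-++ []      y = refl
  drop-++ (a ∷ x) y = drop-++ x y

  take-++-[] : ∀ m (x : Vec A (m ℕ.+ 0)) → take m x ++ [] ≡ x
  take-++-[] zero    []      = refl
  take-++-[] (suc m) (a ∷ x) = cong (a ∷_) (take-++-[] m x)

  -- `2 * m` unfolds to `m + (m + 0)`, hence the trailing `[]`.
  halves : ∀ m → Vec A (2 ℕ.* m) ↔ (Vec A m × Vec A m)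
  halves m = mk↔ₛ′ (λ v → take m v , take m (drop m v)) (λ (x , y) → x ++ (y ++ []))
    (λ (x , y) → cong₂ _,_ (take-++ x _) (trans (cong (take m) (drop-++ x _)) (take-++ y [])))
    (λ v → trans (cong (take m v ++_) (take-++-[] m (drop m v))) (take++drop≡id m v))

  ∷↔× : ∀ {m} → Vec A (suc m) ↔ (A × Vec A m)
  ∷↔× = mk↔ₛ′ uncons (uncurry _∷_) (λ _ → refl) (λ { (_ ∷ _) → refl })

Vec-Bool↔Fin : ∀ k → Vec Bool k ↔ Fin (2 ^ k)
Vec-Bool↔Fin zero    = mk↔ₛ′ (λ _ → Fin.zero) (λ _ → []) (λ { Fin.zero → refl ; (Fin.suc ()) }) (λ { [] → refl })
Vec-Bool↔Fin (suc k) = ↔-trans ∷↔× (↔-trans (↔-sym 2↔Bool ×-↔ Vec-Bool↔Fin k) (↔-sym *↔×))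

infixl 7 _·_ _⊙_

-- Multiplication of ±1 entries, under the encoding of `sign`.
_·_ : Bool → Bool → Bool
a · true  = a
a · false = not a

_⊙_ : ∀ {m} → Vec Bool m → Vec Bool m → Vec Bool m
_⊙_ = zipWith _·_

·-involutive : ∀ a b → a · (a · b) ≡ b
·-involutive true  true  = refl
·-involutive true  false = refl
·-involutive false true  = refl
·-involutive false false = refl

⊙-involutive : ∀ {m} (x y : Vec Bool m) → x ⊙ (x ⊙ y) ≡ y
⊙-involutive []       []       = refl
⊙-involutive (a ∷ x) (b ∷ y) = cong₂ _∷_ (·-involutive a b) (⊙-involutive x y)

map-not-involutive : ∀ {m} (x : Vec Bool m) → map not (map not x) ≡ x
map-not-involutive x = trans (sym (map-∘ not not x)) (trans (map-cong not-involutive x) (map-id x))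

coords : ∀ m → Vec Bool (2 ℕ.* m) ↔ (Vec Bool m × Vec Bool m)
coords m = ↔-trans (halves m) shear
  where
  shear : (Vec Bool m × Vec Bool m) ↔ (Vec Bool m × Vec Bool m)
  shear = mk↔ₛ′ (λ (x , y) → x , x ⊙ y) (λ (x , c) → x , x ⊙ c)
    (λ (x , c) → cong (x ,_) (⊙-involutive x c))
    (λ (x , y) → cong (x ,_) (⊙-involutive x y))

module _ {A : Set} where

  attach± : ∀ {m} → Vec Bool m → A ⊎ A → A × Vec Bool m
  attach± c (inj₁ a) = a , c
  attach± c (inj₂ a) = a , map not c

  signSplit : ∀ {k} → (A × Vec Bool (suc k)) ↔ (Vec Bool k × (A ⊎ A))
  signSplit = mk↔ₛ′ normalise (λ (t , u) → attach± (true ∷ t) u)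
    (λ { (t , inj₁ a) → refl
       ; (t , inj₂ a) → cong (_, inj₂ a) (map-not-involutive t) })
    (λ { (a , true ∷ t)  → refl
       ; (a , false ∷ t) → cong (λ t′ → a , false ∷ t′) (map-not-involutive t) })
    where
    normalise : ∀ {k} → A × Vec Bool (suc k) → Vec Bool k × (A ⊎ A)
    normalise (a , true ∷ t)  = t , inj₁ a
    normalise (a , false ∷ t) = map not t , inj₂ a

classes : ∀ k → Vec Bool (2 ℕ.* suc k) ↔ (Fin (2 ^ k) × (Vec Bool (suc k) ⊎ Vec Bool (suc k)))
classes k = ↔-trans (coords (suc k)) (↔-trans signSplit (Vec-Bool↔Fin k ×-↔ ↔-refl))

-- ℤ arithmetic is opened locally: the statement below needs ℕ's `_*_`.
module _ where
  open import Data.Integer using (+_; -[1+_]; -_; _+_; _*_)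
  open import Data.Integer.Properties using (+-identityˡ; +-identityʳ; +-inverseʳ; +-assoc; neg-distrib-+)

  sign-·-cancelʳ : ∀ a b c → sign (a · c) * sign (b · c) ≡ sign a * sign b
  sign-·-cancelʳ a     b     true  = refl
  sign-·-cancelʳ true  true  false = refl
  sign-·-cancelʳ true  false false = refl
  sign-·-cancelʳ false true  false = refl
  sign-·-cancelʳ false false false = refl

  sign-·-flipʳ : ∀ a b c → sign (a · c) * sign (b · not c) ≡ - (sign a * sign b)
  sign-·-flipʳ true  true  true  = refl
  sign-·-flipʳ true  false true  = refl
  sign-·-flipʳ false true  true  = refl
  sign-·-flipʳ false false true  = refl
  sign-·-flipʳ true  true  false = refl
  sign-·-flipʳ true  false false = refl
  sign-·-flipʳ false true  false = refl
  sign-·-flipʳ false false false = refl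

  dot-⊙-cancelʳ : ∀ {m} (x y c : Vec Bool m) → dot (x ⊙ c) (y ⊙ c) ≡ dot x y
  dot-⊙-cancelʳ []      []      []      = refl
  dot-⊙-cancelʳ (a ∷ x) (b ∷ y) (c ∷ d) = cong₂ _+_ (sign-·-cancelʳ a b c) (dot-⊙-cancelʳ x y d)

  dot-⊙-flipʳ : ∀ {m} (x y c : Vec Bool m) → dot (x ⊙ c) (y ⊙ map not c) ≡ - dot x y
  dot-⊙-flipʳ []      []      []      = refl
  dot-⊙-flipʳ (a ∷ x) (b ∷ y) (c ∷ d) =
    trans (cong₂ _+_ (sign-·-flipʳ a b c) (dot-⊙-flipʳ x y d))
          (sym (neg-distrib-+ (sign a * sign b) (dot x y)))

  dot-++ : ∀ {m p} (x x′ : Vec Bool m) (y y′ : Vec Bool p) →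
           dot (x ++ y) (x′ ++ y′) ≡ dot x x′ + dot y y′
  dot-++ []      []       y y′ = sym (+-identityˡ (dot y y′))
  dot-++ (a ∷ x) (a′ ∷ x′) y y′ =
    trans (cong (_+_ (sign a * sign a′)) (dot-++ x x′ y y′))
          (sym (+-assoc (sign a * sign a′) (dot x x′) (dot y y′)))

  z+z≡0⇔z≡0 : ∀ z → z + z ≡ + 0 ⇔ z ≡ + 0
  z+z≡0⇔z≡0 z = mk⇔ (double≡0 z) (λ { refl → refl })
    where
    double≡0 : ∀ z → z + z ≡ + 0 → z ≡ + 0
    double≡0 (+ zero)  _  = refl
    double≡0 (+ suc n) ()
    double≡0 -[1+ n ]  ()

  dot-halves : ∀ {m} (x y x′ y′ : Vec Bool m) →
    dot (Inverse.from (halves m) (x , y)) (Inverse.from (halves m) (x′ , y′)) ≡ dot x x′ + dot y y′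
  dot-halves x y x′ y′ = begin
    dot (x ++ (y ++ [])) (x′ ++ (y′ ++ []))  ≡⟨ dot-++ x x′ _ _ ⟩
    dot x x′ + dot (y ++ []) (y′ ++ [])      ≡⟨ cong (_+_ (dot x x′)) (dot-++ y y′ [] []) ⟩
    dot x x′ + (dot y y′ + + 0)              ≡⟨ cong (_+_ (dot x x′)) (+-identityʳ (dot y y′)) ⟩
    dot x x′ + dot y y′                      ∎
    where open ≡-Reasoning

  module _ {m : ℕ} where
    open Inverse (coords m) using (from)

    orthogonal-sameSide⇔ : ∀ (x y c : Vec Bool m) → dot (from (x , c)) (from (y , c)) ≡ + 0 ⇔ dot x y ≡ + 0
    orthogonal-sameSide⇔ x y c = subst (λ z → z ≡ + 0 ⇔ dot x y ≡ + 0)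
      (sym (trans (dot-halves x (x ⊙ c) y (y ⊙ c)) (cong (_+_ (dot x y)) (dot-⊙-cancelʳ x y c))))
      (z+z≡0⇔z≡0 (dot x y))

    orthogonal-oppositeSides : ∀ (x y c : Vec Bool m) → dot (from (x , c)) (from (y , map not c)) ≡ + 0
    orthogonal-oppositeSides x y c = begin
      dot (from (x , c)) (from (y , map not c))  ≡⟨ dot-halves x (x ⊙ c) y (y ⊙ map not c) ⟩
      dot x y + dot (x ⊙ c) (y ⊙ map not c)     ≡⟨ cong (_+_ (dot x y)) (dot-⊙-flipʳ x y c) ⟩
      dot x y + - dot x y                         ≡⟨ +-inverseʳ (dot x y) ⟩
      + 0                                         ∎
      where open ≡-Reasoning

    orthogonal⇔join-adjacent : ∀ (c : Vec Bool m) u w →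
      dot (from (attach± c u)) (from (attach± c w)) ≡ + 0 ⇔ Adj (join (Ω m) (Ω m)) u w
    orthogonal⇔join-adjacent c (inj₁ x) (inj₁ y) = orthogonal-sameSide⇔ x y c
    orthogonal⇔join-adjacent c (inj₂ x) (inj₂ y) = orthogonal-sameSide⇔ x y (map not c)
    orthogonal⇔join-adjacent c (inj₁ x) (inj₂ y) = mk⇔ (λ _ → tt) (λ _ → orthogonal-oppositeSides x y c)
    orthogonal⇔join-adjacent c (inj₂ x) (inj₁ y) = mk⇔ (λ _ → tt) (λ _ →
      subst (λ c′ → dot (from (x , map not c)) (from (y , c′)) ≡ + 0)
            (map-not-involutive c) (orthogonal-oppositeSides x y (map not c)))

open import Data.Nat using (_*_)

mainTheorem8 : (n : ℕ) → 1 ≤ n →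
    Σ (V (Ω (2 * n)) → Fin (2 ^ (n ∸ 1))) λ part →
      (i : Fin (2 ^ (n ∸ 1))) →
        induced (Ω (2 * n)) (λ v → part v ≡ i) ≅ join (Ω n) (Ω n)
mainTheorem8 (suc k) _ = proj₁ ∘ Inverse.to (classes k) , λ i →
  fibre-≅ (Decidable⇒UIP.≡-irrelevant Fin._≟_) (classes k) i
    (orthogonal⇔join-adjacent (true ∷ Inverse.from (Vec-Bool↔Fin k) i))
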